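{- For an integer $n\ge 2$, let $E_n$ be the descending staircase configuration consisting of the $n$ cells $[i,i+1]\times[-i,-i+1]$ for $i=0,1,\dots,n-1$ (each cell touches the next one only at a corner, the next one lying diagonally below and to the right). Then: (1) for every $n\ge 2$, $E_n$ is embroiderable; (2) $E_n$ is strongly embroiderable if and only if $n=2$.
   Context: Vertices are the points of $\mathbb Z^2$; a cell is a square $[a,a+1]\times[b,b+1]$ with $(a,b)\in\mathbb Z^2$; a configuration is a finite set of cells. Two vertices are adjacent if at distance $1$. The lower diagonal of a cell joins its top-right corner to its bottom-left corner; the upper diagonal joins its top-left corner to its bottom-right corner. An embroidery of a configuration $C$ with $n$ cells is a sequence of points $x_0,\dots,x_{4n-1}\in\mathbb Z^2$ such that the front stitches $[x_{2k},x_{2k+1}]$ ($0\le k\le 2n-1$) are exactly the $2n$ diagonals of the cells of $C$, each once (in either direction); the back stitches $[x_{2k+1},x_{2k+2}]$ ($0\le k\le 2n-2$) satisfy $x_{2k+1}\ne x_{2k+2}$; and for each cell its lower diagonal is stitched before its upper diagonal. $C$ is embroiderable if it has an embroidery of total thread length $2n(1+\sqrt2)-1$, i.e. every back stitch joins two adjacent vertices. $C$ is strongly embroiderable if it has an embroidery in which every back stitch joins adjacent vertices and additionally $x_{4n-1}$ is adjacent to $x_0$ (thread length $2n(1+\sqrt2)$ returning to the start). -}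

module Defs where

open import Data.Nat using (ℕ; suc; _*_; _<_; _∸_)
open import Data.Integer using (ℤ; +_; -_; _-_; ∣_∣) renaming (_+_ to _+ℤ_)
import Data.Nat as ℕ
open import Data.Fin using (Fin; toℕ)
open import Data.Product using (_×_; _,_; proj₁; proj₂; Σ; ∃)
open import Data.Sum using (_⊎_)
open import Relation.Binary.PropositionalEquality using (_≡_)
open import Relation.Nullary using (¬_)
open import Function.Definitions using (Bijective; Injective)

Point : Set
Point = ℤ × ℤ

-- A cell [a,a+1]×[b,b+1] is represented by its bottom-left corner (a,b).
Cell : Set
Cell = ℤ × ℤ

-- Two vertices are adjacent iff at (Euclidean) distance 1, i.e. |Δx|+|Δy| = 1 in ℤ².
Adjacent : Point → Point → Set
Adjacent (a , b) (c , d) = ∣ a - c ∣ ℕ.+ ∣ b - d ∣ ≡ 1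

data Dir : Set where
  lower upper : Dir

-- Endpoints of a diagonal (orientation irrelevant, see SameSegment).
-- lower: top-right corner to bottom-left corner; upper: top-left to bottom-right.
diagonal : Cell → Dir → Point × Point
diagonal (a , b) lower = ((a +ℤ + 1) , (b +ℤ + 1)) , (a , b)
diagonal (a , b) upper = (a , (b +ℤ + 1)) , ((a +ℤ + 1) , b)

SameSegment : Point × Point → Point × Point → Set
SameSegment (p , q) (p' , q') = ((p , q) ≡ (p' , q')) ⊎ ((p , q) ≡ (q' , p'))

-- A configuration of n cells is given by an injective enumeration c : Fin n → Cell
-- (a finite set of n distinct cells).
-- An embroidery x₀,…,x_{4n-1} is recorded as its 2n front stitches
-- s k = (x_{2k} , x_{2k+1}), k < 2n; the back stitch after front stitch k
-- is [proj₂ (s k), proj₁ (s (k+1))].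
record Embroidery (n : ℕ) (c : Fin n → Cell) : Set where
  field
    stitch   : Fin (2 * n) → Point × Point
    position : Fin n × Dir → Fin (2 * n)
    position-bij : Bijective _≡_ _≡_ position
    sews     : ∀ i d → SameSegment (stitch (position (i , d))) (diagonal (c i) d)
    lower-first : ∀ i → toℕ (position (i , lower)) < toℕ (position (i , upper))
    back-nondeg : ∀ k l → toℕ l ≡ suc (toℕ k) → ¬ (proj₂ (stitch k) ≡ proj₁ (stitch l))

open Embroidery public

-- All back stitches join adjacent vertices (thread length 2n(1+√2) - 1).
ShortBackStitches : ∀ {n c} → Embroidery n c → Set
ShortBackStitches {n} e =
  ∀ k l → toℕ l ≡ suc (toℕ k) → Adjacent (proj₂ (stitch e k)) (proj₁ (stitch e l))

Closing : ∀ {n c} → Embroidery n c → Set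
Closing {n} e =
  ∀ k l → toℕ k ≡ 2 * n ∸ 1 → toℕ l ≡ 0 → Adjacent (proj₂ (stitch e k)) (proj₁ (stitch e l))

Embroiderable : (n : ℕ) → (Fin n → Cell) → Set
Embroiderable n c = Σ (Embroidery n c) ShortBackStitches

StronglyEmbroiderable : (n : ℕ) → (Fin n → Cell) → Set
StronglyEmbroiderable n c =
  Σ (Embroidery n c) (λ e → ShortBackStitches e × Closing e)

staircase : (n : ℕ) → Fin n → Cell
staircase n i = (+ toℕ i) , (- (+ toℕ i))

-- E_n is invariant under the shift (a,b) ↦ (a+1,b-1), which maps cell q to
-- cell q+1.  Sewing cell by cell, lower diagonal (bottom-left to top-right) then upper
-- diagonal, the thread stitch m+2 is the shift of stitch m, so the unit back stitches between
-- consecutive stitches follow by induction from the first two.  For E_2, reversing the last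
-- stitch brings the thread back next to its start.
--
-- Impossibility for n ≥ 3.  Give the point (a,b) the level a - b + 1.  Both ends of the lower
-- diagonal of cell q lie at level 2q+1, those of the upper diagonal at 2q and 2q+2, and a unit
-- back stitch changes the level by exactly one.  A closed embroidery is thus reduced to a
-- cyclic "level tour" of labelled stitches (LevelTour).  Level 0 occurs only on the upper
-- diagonal U₀ of cell 0 and level 1 only on the lower diagonal L₀, which forces L₀ and U₀ to
-- be neighbours on the cycle; following the thread two more steps in each direction places
-- the diagonals of cell 1 (and then cell 2) in positions contradicting lower-before-upper.

module Submission where

open import Defs
open import Data.Nat using (ℕ; zero; suc; _+_; _*_; _∸_; _≤_; _<_; _≥_; z≤n; s≤s)
import Data.Nat.Properties as ℕ
open import Data.Integer using (ℤ; +_; -_; -[1+_]; _-_; ∣_∣) renaming (_+_ to _+ℤ_)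
import Data.Integer.Properties as ℤ
open import Data.Integer.Tactic.RingSolver using (solve-∀)
open import Data.Fin using (Fin; toℕ; fromℕ<; cast; combine; remQuot)
import Data.Fin as Fin
import Data.Fin.Properties as Fin
open import Data.Product using (_×_; _,_; proj₁; proj₂; ∃; map; swap; uncurry)
open import Data.Product.Properties using (×-≡,≡→≡)
open import Data.Sum using (_⊎_; inj₁; inj₂)
open import Function.Definitions using (Bijective; Injective)
open import Relation.Binary.PropositionalEquality
open import Relation.Nullary using (¬_; contradiction)
open import Data.Empty using (⊥)
open import Function.Bundles using (_⇔_; mk⇔)

-- Adjacent points are distinct, so unit back stitches are never degenerate.
adjacent⇒distinct : ∀ p q → Adjacent p q → ¬ p ≡ q
adjacent⇒distinct (a , b) _ h refl rewrite ℤ.i≡j⇒i-j≡0 {a} refl | ℤ.i≡j⇒i-j≡0 {b} refl with h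
... | ()

-- Translation by (1,-1) maps each cell of the staircase onto the next one; it preserves
-- adjacency.
shift : Point → Point
shift (a , b) = a +ℤ + 1 , b - + 1

shift-adjacent : ∀ p q → Adjacent p q → Adjacent (shift p) (shift q)
shift-adjacent (a , b) (c , d) h =
  subst₂ (λ x y → ∣ x ∣ + ∣ y ∣ ≡ 1) (sym (cancel+ a c)) (sym (cancel- b d)) h
  where
  cancel+ : ∀ x y → (x +ℤ + 1) - (y +ℤ + 1) ≡ x - y
  cancel+ = solve-∀
  cancel- : ∀ x y → (x - + 1) - (y - + 1) ≡ x - y
  cancel- = solve-∀

stairCell : ℕ → Cell
stairCell q = + q , - (+ q)

shift-stairCell : ∀ q → (+ q +ℤ + 1 , - (+ q) - + 1) ≡ stairCell (suc q)
shift-stairCell q = cong₂ _,_ (cong +_ q+1≡1+q) (trans (negate (+ q)) (cong (λ k → - (+ k)) q+1≡1+q))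
  where
  q+1≡1+q : q + 1 ≡ suc q
  q+1≡1+q = ℕ.+-comm q 1
  negate : ∀ x → - x - + 1 ≡ - (x +ℤ + 1)
  negate = solve-∀

traversal : Cell → Dir → Point × Point
traversal c lower = swap (diagonal c lower)
traversal c upper = diagonal c upper

traversal-sews : ∀ c d → SameSegment (traversal c d) (diagonal c d)
traversal-sews c lower = inj₂ refl
traversal-sews c upper = inj₁ refl

shifted-top : ∀ y → (y +ℤ + 1) - + 1 ≡ (y - + 1) +ℤ + 1
shifted-top = solve-∀

-- Shifting a traversal of a cell gives the traversal of the shifted cell; the only point is
-- that the top edge y+1 of the cell is moved to (y+1)-1 = (y-1)+1.
shift-traversal : ∀ a b d → map shift shift (traversal (a , b) d) ≡ traversal (a +ℤ + 1 , b - + 1) d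
shift-traversal a b lower = cong (λ y → (a +ℤ + 1 , b - + 1) , (a +ℤ + 1 +ℤ + 1 , y)) (shifted-top b)
shift-traversal a b upper = cong (λ y → (a +ℤ + 1 , y) , (a +ℤ + 1 +ℤ + 1 , b - + 1)) (shifted-top b)

thread : ℕ → Point × Point
thread 0 = traversal (stairCell 0) lower
thread 1 = traversal (stairCell 0) upper
thread (suc (suc m)) = map shift shift (thread m)

thread-short : ∀ m → Adjacent (proj₂ (thread m)) (proj₁ (thread (suc m)))
thread-short 0 = refl
thread-short 1 = refl
thread-short (suc (suc m)) = shift-adjacent (proj₂ (thread m)) (proj₁ (thread (suc m))) (thread-short m)

dirFin : Dir → Fin 2
dirFin lower = Fin.zero
dirFin upper = Fin.suc Fin.zero

finDir : Fin 2 → Dir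
finDir Fin.zero = lower
finDir (Fin.suc Fin.zero) = upper

dirFin-finDir : ∀ j → dirFin (finDir j) ≡ j
dirFin-finDir Fin.zero = refl
dirFin-finDir (Fin.suc Fin.zero) = refl

dirFin-injective : ∀ {d d′} → dirFin d ≡ dirFin d′ → d ≡ d′
dirFin-injective {lower} {lower} _ = refl
dirFin-injective {upper} {upper} _ = refl

thread-sews : ∀ q d → thread (2 * q + toℕ (dirFin d)) ≡ traversal (stairCell q) d
thread-sews zero lower = refl
thread-sews zero upper = refl
thread-sews (suc q) d = begin
  thread (2 * suc q + j)                          ≡⟨ cong (λ k → thread (k + j)) (ℕ.*-suc 2 q) ⟩
  map shift shift (thread (2 * q + j))            ≡⟨ cong (map shift shift) (thread-sews q d) ⟩
  map shift shift (traversal (stairCell q) d)     ≡⟨ shift-traversal (+ q) (- (+ q)) d ⟩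
  traversal (+ q +ℤ + 1 , - (+ q) - + 1) d        ≡⟨ cong (λ c → traversal c d) (shift-stairCell q) ⟩
  traversal (stairCell (suc q)) d                 ∎
  where
  open ≡-Reasoning
  j = toℕ (dirFin d)

stitchOrder : ∀ {n} → Fin n × Dir → Fin (2 * n)
stitchOrder {n} (i , d) = cast (ℕ.*-comm n 2) (combine i (dirFin d))

toℕ-stitchOrder : ∀ {n} (i : Fin n) d → toℕ (stitchOrder (i , d)) ≡ 2 * toℕ i + toℕ (dirFin d)
toℕ-stitchOrder i d = trans (Fin.toℕ-cast _ (combine i (dirFin d))) (Fin.toℕ-combine i (dirFin d))

stitchOrder-lower-first : ∀ {n} (i : Fin n) → toℕ (stitchOrder (i , lower)) < toℕ (stitchOrder (i , upper))
stitchOrder-lower-first i rewrite toℕ-stitchOrder i lower | toℕ-stitchOrder i upper =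
  ℕ.+-monoʳ-< (2 * toℕ i) (s≤s z≤n)

stitchOrder-bijective : ∀ {n} → Bijective _≡_ _≡_ (stitchOrder {n})
stitchOrder-bijective {n} = injective , surjective
  where
  injective : Injective _≡_ _≡_ (stitchOrder {n})
  injective {i , d} {i′ , d′} eq =
    let i≡i′ , j≡j′ = Fin.combine-injective i (dirFin d) i′ (dirFin d′) (uncast eq)
    in ×-≡,≡→≡ (i≡i′ , dirFin-injective j≡j′)
    where
    uncast : ∀ {x y} → cast (ℕ.*-comm n 2) x ≡ cast (ℕ.*-comm n 2) y → x ≡ y
    uncast {x} {y} e = begin
      x                                            ≡⟨ Fin.cast-involutive (ℕ.*-comm 2 n) (ℕ.*-comm n 2) x ⟨
      cast (ℕ.*-comm 2 n) (cast (ℕ.*-comm n 2) x)  ≡⟨ cong (cast (ℕ.*-comm 2 n)) e ⟩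
      cast (ℕ.*-comm 2 n) (cast (ℕ.*-comm n 2) y)  ≡⟨ Fin.cast-involutive (ℕ.*-comm 2 n) (ℕ.*-comm n 2) y ⟩
      y                                            ∎
      where open ≡-Reasoning
  surjective : ∀ k → ∃ λ x → ∀ {z} → z ≡ x → stitchOrder z ≡ k
  surjective k = (i , finDir j) , λ { refl → hits }
    where
    open ≡-Reasoning
    k′ = cast (ℕ.*-comm 2 n) k
    i = proj₁ (remQuot {n} 2 k′)
    j = proj₂ (remQuot {n} 2 k′)
    hits : stitchOrder (i , finDir j) ≡ k
    hits = begin
      cast (ℕ.*-comm n 2) (combine i (dirFin (finDir j)))
        ≡⟨ cong (λ j′ → cast (ℕ.*-comm n 2) (combine i j′)) (dirFin-finDir j) ⟩
      cast (ℕ.*-comm n 2) (uncurry combine (remQuot {n} 2 k′))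
        ≡⟨ cong (cast (ℕ.*-comm n 2)) (Fin.combine-remQuot {n} 2 k′) ⟩
      cast (ℕ.*-comm n 2) k′
        ≡⟨ Fin.cast-involutive (ℕ.*-comm n 2) (ℕ.*-comm 2 n) k ⟩
      k ∎

module FromSequence {n} {c : Fin n → Cell} (s : ℕ → Point × Point)
  (order : Fin n × Dir → Fin (2 * n)) (order-bijective : Bijective _≡_ _≡_ order)
  (s-sews : ∀ i d → SameSegment (s (toℕ (order (i , d)))) (diagonal (c i) d))
  (order-lower-first : ∀ i → toℕ (order (i , lower)) < toℕ (order (i , upper)))
  (s-short : ∀ m → suc m < 2 * n → Adjacent (proj₂ (s m)) (proj₁ (s (suc m))))
  where

  short : ∀ (k l : Fin (2 * n)) → toℕ l ≡ suc (toℕ k) → Adjacent (proj₂ (s (toℕ k))) (proj₁ (s (toℕ l)))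
  short k l l≡k+1 = subst (λ m → Adjacent (proj₂ (s (toℕ k))) (proj₁ (s m))) (sym l≡k+1)
    (s-short (toℕ k) (subst (_< 2 * n) l≡k+1 (Fin.toℕ<n l)))

  embroidery : Embroidery n c
  embroidery = record
    { stitch = λ k → s (toℕ k)
    ; position = order
    ; position-bij = order-bijective
    ; sews = s-sews
    ; lower-first = order-lower-first
    ; back-nondeg = λ k l l≡k+1 → adjacent⇒distinct (proj₂ (s (toℕ k))) (proj₁ (s (toℕ l))) (short k l l≡k+1)
    }

  embroiderable : Embroiderable n c
  embroiderable = embroidery , short

  strongly-embroiderable : Adjacent (proj₂ (s (2 * n ∸ 1))) (proj₁ (s 0)) → StronglyEmbroiderable n c
  strongly-embroiderable closes = embroidery , short , λ k l k≡last l≡0 →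
    subst₂ (λ x y → Adjacent (proj₂ (s x)) (proj₁ (s y))) (sym k≡last) (sym l≡0) closes

staircase-embroiderable : ∀ n → Embroiderable n (staircase n)
staircase-embroiderable n =
  FromSequence.embroiderable thread stitchOrder stitchOrder-bijective thread-sews′
    stitchOrder-lower-first (λ m _ → thread-short m)
  where
  thread-sews′ : ∀ i d → SameSegment (thread (toℕ (stitchOrder (i , d)))) (diagonal (staircase n i) d)
  thread-sews′ i d rewrite toℕ-stitchOrder i d | thread-sews (toℕ i) d = traversal-sews (staircase n i) d

-- For E_2, running the last diagonal backwards makes the thread return next to its start.
closedThread₂ : ℕ → Point × Point
closedThread₂ 3 = swap (thread 3)
closedThread₂ m = thread m

staircase₂-strongly-embroiderable : StronglyEmbroiderable 2 (staircase 2)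
staircase₂-strongly-embroiderable =
  FromSequence.strongly-embroiderable closedThread₂ stitchOrder stitchOrder-bijective sews₂
    stitchOrder-lower-first short₂ refl
  where
  sews₂ : ∀ i d → SameSegment (closedThread₂ (toℕ (stitchOrder (i , d)))) (diagonal (staircase 2 i) d)
  sews₂ Fin.zero lower = inj₂ refl
  sews₂ Fin.zero upper = inj₁ refl
  sews₂ (Fin.suc Fin.zero) lower = inj₂ refl
  sews₂ (Fin.suc Fin.zero) upper = inj₂ refl
  short₂ : ∀ m → suc m < 4 → Adjacent (proj₂ (closedThread₂ m)) (proj₁ (closedThread₂ (suc m)))
  short₂ 0 _ = refl
  short₂ 1 _ = refl
  short₂ 2 _ = refl
  short₂ (suc (suc (suc m))) (s≤s (s≤s (s≤s (s≤s ()))))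

-- On E_n the lower diagonal of cell q has both endpoints at
-- level 2q+1, the upper one has endpoints at levels 2q and 2q+2, and adjacent points have
-- levels differing by exactly one; the whole impossibility argument happens on levels.
level : Point → ℤ
level (a , b) = a - b +ℤ + 1

_~_ : ℕ → ℕ → Set
a ~ b = a ≡ suc b ⊎ b ≡ suc a

~-sym : ∀ {a b} → a ~ b → b ~ a
~-sym (inj₁ e) = inj₂ e
~-sym (inj₂ e) = inj₁ e

neighbours-of-zero : ∀ {a} → a ~ 0 → a ≡ 1
neighbours-of-zero (inj₁ a≡1) = a≡1

neighbours-of-two : ∀ {a} → a ~ 2 → a ≡ 1 ⊎ a ≡ 3
neighbours-of-two (inj₁ a≡3) = inj₂ a≡3
neighbours-of-two (inj₂ 2≡a+1) = inj₁ (sym (ℕ.suc-injective 2≡a+1))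

neighbours-of-odd : ∀ {a} m → a ~ suc (2 * m) → a ≡ 2 * m ⊎ a ≡ 2 * suc m
neighbours-of-odd m (inj₁ a≡2m+2) = inj₂ (trans a≡2m+2 (sym (ℕ.*-suc 2 m)))
neighbours-of-odd m (inj₂ 2m+1≡a+1) = inj₁ (sym (ℕ.suc-injective 2m+1≡a+1))

unit-vector : ∀ x y → ∣ x ∣ + ∣ y ∣ ≡ 1 → x - y ≡ + 1 ⊎ x - y ≡ -[1+ 0 ]
unit-vector (+ 0) (+ 1) _ = inj₂ refl
unit-vector (+ 0) -[1+ 0 ] _ = inj₁ refl
unit-vector (+ 1) (+ 0) _ = inj₁ refl
unit-vector -[1+ 0 ] (+ 0) _ = inj₂ refl
unit-vector (+ 0) (+ 0) ()
unit-vector (+ 0) (+ suc (suc k)) ()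
unit-vector (+ 0) -[1+ suc k ] ()
unit-vector (+ 1) (+ suc k) ()
unit-vector (+ 1) -[1+ k ] ()
unit-vector (+ suc (suc j)) y ()
unit-vector -[1+ 0 ] (+ suc k) ()
unit-vector -[1+ 0 ] -[1+ k ] ()
unit-vector -[1+ suc j ] y ()

difference-one : ∀ a b → + a - + b ≡ + 1 → a ≡ suc b
difference-one a b e = ℤ.+-injective (begin
  + a                  ≡⟨ split (+ a) (+ b) ⟩
  (+ a - + b) +ℤ + b   ≡⟨ cong (_+ℤ + b) e ⟩
  + suc b              ∎)
  where
  open ≡-Reasoning
  split : ∀ x y → x ≡ (x - y) +ℤ y
  split = solve-∀

adjacent-levels : ∀ p q {a b} → Adjacent p q → level p ≡ + a → level q ≡ + b → a ~ b
adjacent-levels (x , y) (x′ , y′) {a} {b} adj p≡a q≡b with unit-vector (x - x′) (y - y′) adj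
... | inj₁ up = inj₁ (difference-one a b (trans (cong₂ _-_ (sym p≡a) (sym q≡b)) (trans (drop x y x′ y′) up)))
  where
  drop : ∀ x y x′ y′ → (x - y +ℤ + 1) - (x′ - y′ +ℤ + 1) ≡ (x - x′) - (y - y′)
  drop = solve-∀
... | inj₂ down = inj₂ (difference-one b a (trans (cong₂ _-_ (sym q≡b) (sym p≡a)) (trans (flip x y x′ y′) (cong -_ down))))
  where
  flip : ∀ x y x′ y′ → (x′ - y′ +ℤ + 1) - (x - y +ℤ + 1) ≡ - ((x - x′) - (y - y′))
  flip = solve-∀

data Ends : ℕ → Dir → ℕ → ℕ → Set where
  lower-ends    : ∀ q → Ends q lower (suc (2 * q)) (suc (2 * q))
  upper-rising  : ∀ q → Ends q upper (2 * q) (2 * suc q)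
  upper-falling : ∀ q → Ends q upper (2 * suc q) (2 * q)

Ends-swap : ∀ {q d g h} → Ends q d g h → Ends q d h g
Ends-swap (lower-ends q) = lower-ends q
Ends-swap (upper-rising q) = upper-falling q
Ends-swap (upper-falling q) = upper-rising q

odd-level : ∀ {q d g h} m → Ends q d g h → g ≡ suc (2 * m) → q ≡ m × d ≡ lower
odd-level m (lower-ends q) e = ℕ.*-cancelˡ-≡ q m 2 (ℕ.suc-injective e) , refl
odd-level m (upper-rising q) e = contradiction e (ℕ.even≢odd q m)
odd-level m (upper-falling q) e = contradiction e (ℕ.even≢odd (suc q) m)

even-level : ∀ {q d g h} m → Ends q d g h → g ≡ 2 * m → d ≡ upper × (q ≡ m ⊎ suc q ≡ m)
even-level m (lower-ends q) e = contradiction (sym e) (ℕ.even≢odd m q)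
even-level m (upper-rising q) e = refl , inj₁ (ℕ.*-cancelˡ-≡ q m 2 e)
even-level m (upper-falling q) e = refl , inj₂ (ℕ.*-cancelˡ-≡ (suc q) m 2 e)

lower-level : ∀ {q g h} → Ends q lower g h → g ≡ suc (2 * q) × h ≡ suc (2 * q)
lower-level (lower-ends q) = refl , refl

upper₀-levels : ∀ {g h} → Ends 0 upper g h → (g ≡ 0 × h ≡ 2) ⊎ (g ≡ 2 × h ≡ 0)
upper₀-levels (upper-rising 0) = inj₁ (refl , refl)
upper₀-levels (upper-falling 0) = inj₂ (refl , refl)

record Levels (s : Point × Point) (q : ℕ) (d : Dir) : Set where
  constructor levels
  field
    entry exit  : ℕ
    entry-level : level (proj₁ s) ≡ + entry
    exit-level  : level (proj₂ s) ≡ + exit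
    ends        : Ends q d entry exit

diagonal-levels : ∀ q d → Levels (diagonal (stairCell q) d) q d
diagonal-levels q lower =
  levels _ _ (trans (top-right (+ q)) odd) (trans (bottom-left (+ q)) odd) (lower-ends q)
  where
  odd : + 1 +ℤ (+ q +ℤ + q) ≡ + suc (2 * q)
  odd = cong (λ k → + suc k) (cong (λ k → q + k) (sym (ℕ.+-identityʳ q)))
  top-right : ∀ x → (x +ℤ + 1) - (- x +ℤ + 1) +ℤ + 1 ≡ + 1 +ℤ (x +ℤ x)
  top-right = solve-∀
  bottom-left : ∀ x → x - (- x) +ℤ + 1 ≡ + 1 +ℤ (x +ℤ x)
  bottom-left = solve-∀
diagonal-levels q upper =
  levels _ _ (trans (top-left (+ q)) double) (trans (bottom-right (+ q)) double+2) (upper-rising q)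
  where
  double : + q +ℤ + q ≡ + (2 * q)
  double = cong (λ k → + (q + k)) (sym (ℕ.+-identityʳ q))
  double+2 : + 2 +ℤ (+ q +ℤ + q) ≡ + (2 * suc q)
  double+2 = trans (cong (+ 2 +ℤ_) double) (cong +_ (sym (ℕ.*-suc 2 q)))
  top-left : ∀ x → x - (- x +ℤ + 1) +ℤ + 1 ≡ x +ℤ x
  top-left = solve-∀
  bottom-right : ∀ x → (x +ℤ + 1) - (- x) +ℤ + 1 ≡ + 2 +ℤ (x +ℤ x)
  bottom-right = solve-∀

sewn-levels : ∀ s q d → SameSegment s (diagonal (stairCell q) d) → Levels s q d
sewn-levels _ q d (inj₁ refl) = diagonal-levels q d
sewn-levels _ q d (inj₂ refl) = let levels g h gl hl e = diagonal-levels q d in levels h g hl gl (Ends-swap e)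

Next : ∀ {N} → Fin N → Fin N → Set
Next {N} t u = toℕ u ≡ suc (toℕ t) ⊎ (toℕ t ≡ N ∸ 1 × toℕ u ≡ 0)

-- The level shadow of a closed embroidery of E_n with unit back stitches: position t sews
-- diagonal `dir t` of cell `cell t`, entering at level `entry t` and leaving at level `exit t`.
record LevelTour (n : ℕ) : Set where
  field
    cell        : Fin (2 * n) → ℕ
    dir         : Fin (2 * n) → Dir
    entry exit  : Fin (2 * n) → ℕ
    ends        : ∀ t → Ends (cell t) (dir t) (entry t) (exit t)
    link        : ∀ t u → Next t u → exit t ~ entry u
    distinct    : ∀ t u → cell t ≡ cell u → dir t ≡ dir u → t ≡ u
    present     : ∀ q → q < n → ∀ d → ∃ λ t → cell t ≡ q × dir t ≡ d
    lower-precedes : ∀ t u → cell t ≡ cell u → dir t ≡ lower → dir u ≡ upper → toℕ t < toℕ u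

module Shadow {n} (e : Embroidery n (staircase n)) (short : ShortBackStitches e) (closing : Closing e) where

  label : Fin (2 * n) → Fin n × Dir
  label t = proj₁ (proj₂ (position-bij e) t)

  position-label : ∀ t → position e (label t) ≡ t
  position-label t = proj₂ (proj₂ (position-bij e) t) refl

  label-position : ∀ x → label (position e x) ≡ x
  label-position x = proj₁ (position-bij e) (position-label (position e x))

  levels-at : ∀ t → Levels (stitch e t) (toℕ (proj₁ (label t))) (proj₂ (label t))
  levels-at t = sewn-levels (stitch e t) (toℕ i) d
    (subst (λ k → SameSegment (stitch e k) (diagonal (staircase n i) d)) (position-label t) (sews e i d))
    where
    i = proj₁ (label t)
    d = proj₂ (label t)

  open Levels

  label-≡ : ∀ {x y : Fin n × Dir} → toℕ (proj₁ x) ≡ toℕ (proj₁ y) → proj₂ x ≡ proj₂ y → x ≡ y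
  label-≡ c d = ×-≡,≡→≡ (Fin.toℕ-injective c , d)

  tour : LevelTour n
  tour = record
    { cell        = λ t → toℕ (proj₁ (label t))
    ; dir         = λ t → proj₂ (label t)
    ; entry       = λ t → entry (levels-at t)
    ; exit        = λ t → exit (levels-at t)
    ; ends        = λ t → ends (levels-at t)
    ; link        = link
    ; distinct    = λ t u c d → trans (sym (position-label t))
                                  (trans (cong (position e) (label-≡ c d)) (position-label u))
    ; present     = present
    ; lower-precedes = λ t u c l≡ u≡ → subst₂ (λ x y → toℕ x < toℕ y)
                      (trans (cong (position e) (label-≡ refl (sym l≡))) (position-label t))
                      (trans (cong (position e) (label-≡ c (sym u≡))) (position-label u))
                      (lower-first e (proj₁ (label t)))
    }
    where
    link : ∀ t u → Next t u → exit (levels-at t) ~ entry (levels-at u)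
    link t u t→u = adjacent-levels (proj₂ (stitch e t)) (proj₁ (stitch e u)) (joined t→u)
                     (exit-level (levels-at t)) (entry-level (levels-at u))
      where
      joined : Next t u → Adjacent (proj₂ (stitch e t)) (proj₁ (stitch e u))
      joined (inj₁ u≡t+1) = short t u u≡t+1
      joined (inj₂ (t≡last , u≡0)) = closing t u t≡last u≡0
    present : ∀ q → q < n → ∀ d → ∃ λ t → toℕ (proj₁ (label t)) ≡ q × proj₂ (label t) ≡ d
    present q q<n d = position e (fromℕ< q<n , d)
      , trans (cong (λ x → toℕ (proj₁ x)) (label-position _)) (Fin.toℕ-fromℕ< q<n)
      , cong proj₂ (label-position _)

-- No closed level tour of E_n exists for n ≥ 3.  The level-0 corner lies only on the upper
-- diagonal U₀ of cell 0 and its neighbours only on the lower diagonal L₀ of cell 0, so U₀ and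
-- L₀ are consecutive.  Following the thread two more steps each way forces the diagonals of
-- cell 1 (and, near the start of the thread, of cell 2) into an order violating lower-first.
module NoClosedTour {n} (T : LevelTour n) (3≤n : 3 ≤ n) where
  open LevelTour T

  N : ℕ
  N = 2 * n

  5≤last : 5 ≤ N ∸ 1
  5≤last = ℕ.∸-monoˡ-≤ 1 (ℕ.*-monoʳ-≤ 2 3≤n)

  small≢last : ∀ {k} → k < 5 → ¬ k ≡ N ∸ 1
  small≢last k<5 refl = ℕ.<⇒≱ k<5 5≤last

  last<N : N ∸ 1 < N
  last<N = pred< N (ℕ.≤-trans (s≤s z≤n) (ℕ.*-monoʳ-≤ 2 3≤n))
    where
    pred< : ∀ m → 1 ≤ m → m ∸ 1 < m
    pred< (suc m) _ = ℕ.n<1+n m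

  second fourth : Fin N
  second = fromℕ< (ℕ.≤-<-trans (ℕ.≤-trans (s≤s z≤n) 5≤last) last<N)
  fourth = fromℕ< (ℕ.≤-<-trans (ℕ.≤-trans (s≤s (s≤s (s≤s z≤n))) 5≤last) last<N)

  toℕ-second : toℕ second ≡ 1
  toℕ-second = Fin.toℕ-fromℕ< _

  toℕ-fourth : toℕ fourth ≡ 3
  toℕ-fourth = Fin.toℕ-fromℕ< _

  next-of : ∀ t → ∃ λ u → Next t u
  next-of t with ℕ.m≤n⇒m<n∨m≡n (Fin.toℕ<n t)
  ... | inj₁ t+1<N = fromℕ< t+1<N , inj₁ (Fin.toℕ-fromℕ< t+1<N)
  ... | inj₂ t+1≡N = fromℕ< (ℕ.≤-<-trans z≤n last<N) ,
                     inj₂ (cong (_∸ 1) t+1≡N , Fin.toℕ-fromℕ< (ℕ.≤-<-trans z≤n last<N))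

  previous-of : ∀ u → ∃ λ t → Next t u
  previous-of u with toℕ u | Fin.toℕ<n u
  ... | zero  | _ = fromℕ< last<N , inj₂ (Fin.toℕ-fromℕ< last<N , refl)
  ... | suc k | k+1<N = fromℕ< k<N , inj₁ (cong suc (sym (Fin.toℕ-fromℕ< k<N)))
    where
    k<N : k < N
    k<N = ℕ.<-trans (ℕ.n<1+n k) k+1<N

  Sews : Fin N → ℕ → Dir → Set
  Sews t q d = cell t ≡ q × dir t ≡ d

  same-position : ∀ {t u q d} → Sews t q d → Sews u q d → t ≡ u
  same-position (ct , dt) (cu , du) = distinct _ _ (trans ct (sym cu)) (trans dt (sym du))

  same-cell : ∀ {t u q q′ d d′} → Sews t q d → Sews u q′ d′ → toℕ t ≡ toℕ u → q ≡ q′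
  same-cell (ct , _) (cu , _) t≡u = trans (sym ct) (trans (cong cell (Fin.toℕ-injective t≡u)) cu)

  ends-of : ∀ {t q d} → Sews t q d → Ends q d (entry t) (exit t)
  ends-of {t} (refl , refl) = ends t

  diagonal-of : ∀ q → q < 3 → ∀ d → ∃ λ t → Sews t q d
  diagonal-of q q<3 d = present q (ℕ.<-≤-trans q<3 3≤n) d

  lower-before : ∀ {u q} → q < 3 → Sews u q upper → ∃ λ t → Sews t q lower × toℕ t < toℕ u
  lower-before {u} q<3 (cu , du) =
    let t , (ct , dt) = diagonal-of _ q<3 lower
    in t , (ct , dt) , lower-precedes t u (trans ct (sym cu)) dt du

  odd-entry : ∀ {t} m → entry t ≡ suc (2 * m) → Sews t m lower
  odd-entry {t} m = odd-level m (ends t)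

  odd-exit : ∀ {t} m → exit t ≡ suc (2 * m) → Sews t m lower
  odd-exit {t} m = odd-level m (Ends-swap (ends t))

  Near : Fin N → ℕ → Set
  Near u m = dir u ≡ upper × (suc (cell u) ≡ m ⊎ cell u ≡ m ⊎ cell u ≡ suc m)

  near-even : ∀ {u g h} m → Ends (cell u) (dir u) g h → g ≡ 2 * m ⊎ g ≡ 2 * suc m → Near u m
  near-even m e (inj₁ g≡2m) with even-level m e g≡2m
  ... | du , inj₁ c = du , inj₂ (inj₁ c)
  ... | du , inj₂ c = du , inj₁ c
  near-even m e (inj₂ g≡2m+2) with even-level (suc m) e g≡2m+2
  ... | du , inj₁ c = du , inj₂ (inj₂ c)
  ... | du , inj₂ c = du , inj₂ (inj₁ (ℕ.suc-injective c))

  after-lower : ∀ {t u m} → Sews t m lower → Next t u → Near u m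
  after-lower {t} {u} {m} st t→u =
    near-even m (ends u) (neighbours-of-odd m (~-sym
      (subst (_~ entry u) (proj₂ (lower-level (ends-of st))) (link t u t→u))))

  before-lower : ∀ {t u m} → Next u t → Sews t m lower → Near u m
  before-lower {t} {u} {m} u→t st =
    near-even m (Ends-swap (ends u)) (neighbours-of-odd m
      (subst (exit u ~_) (proj₁ (lower-level (ends-of st))) (link u t u→t)))

  -- there is no cell -1
  near-zero : ∀ {u} → Near u 0 → Sews u 0 upper ⊎ Sews u 1 upper
  near-zero (du , inj₂ (inj₁ c)) = inj₁ (c , du)
  near-zero (du , inj₂ (inj₂ c)) = inj₂ (c , du)

  near-one : ∀ {u} → Near u 1 → Sews u 0 upper ⊎ Sews u 1 upper ⊎ Sews u 2 upper
  near-one (du , inj₁ c) = inj₁ (ℕ.suc-injective c , du)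
  near-one (du , inj₂ (inj₁ c)) = inj₂ (inj₁ (c , du))
  near-one (du , inj₂ (inj₂ c)) = inj₂ (inj₂ (c , du))

  L₀ U₀ : Fin N
  L₀ = proj₁ (diagonal-of 0 (s≤s z≤n) lower)
  U₀ = proj₁ (diagonal-of 0 (s≤s z≤n) upper)

  L₀-sews : Sews L₀ 0 lower
  L₀-sews = proj₂ (diagonal-of 0 (s≤s z≤n) lower)

  U₀-sews : Sews U₀ 0 upper
  U₀-sews = proj₂ (diagonal-of 0 (s≤s z≤n) upper)

  L₀<U₀ : toℕ L₀ < toℕ U₀
  L₀<U₀ = lower-precedes L₀ U₀ (trans (proj₁ L₀-sews) (sym (proj₁ U₀-sews)))
                               (proj₂ L₀-sews) (proj₂ U₀-sews)

  wraps-around : Next U₀ L₀ → toℕ U₀ ≡ N ∸ 1 × toℕ L₀ ≡ 0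
  wraps-around (inj₁ L₀≡U₀+1) =
    contradiction (subst (toℕ U₀ <_) (sym L₀≡U₀+1) (ℕ.n<1+n _)) (ℕ.<-asym L₀<U₀)
  wraps-around (inj₂ wrap) = wrap

  -- U₀ can not both follow and precede L₀: the cycle is longer than two
  no-back-and-forth : toℕ U₀ ≡ suc (toℕ L₀) → ¬ Next U₀ L₀
  no-back-and-forth U₀≡L₀+1 U₀→L₀ =
    let U₀≡last , L₀≡0 = wraps-around U₀→L₀
    in small≢last (s≤s (s≤s z≤n)) (trans (sym (trans U₀≡L₀+1 (cong suc L₀≡0))) U₀≡last)

  -- U₀'s level-0 end is followed by L₀, so U₀ is the last stitch and L₀ the first
  falling-wraps : exit U₀ ≡ 0 → toℕ U₀ ≡ N ∸ 1 × toℕ L₀ ≡ 0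
  falling-wraps exit≡0 =
    let u , U₀→u = next-of U₀
        u-sews = odd-entry 0 (neighbours-of-zero (~-sym (subst (_~ entry u) exit≡0 (link U₀ u U₀→u))))
    in wraps-around (subst (Next U₀) (same-position u-sews L₀-sews) U₀→u)

  -- then the second stitch, an upper diagonal next to L₀, can neither be U₀ (the last one)
  -- nor the upper diagonal of cell 1 (whose lower diagonal would have to come first)
  falling : exit U₀ ≡ 0 → ⊥
  falling exit≡0 with falling-wraps exit≡0
  ... | U₀≡last , L₀≡0
    with near-zero (after-lower L₀-sews (inj₁ (trans toℕ-second (cong suc (sym L₀≡0)))))
  ... | inj₁ second-U₀ = small≢last (s≤s (s≤s z≤n))
          (trans (sym toℕ-second) (trans (cong toℕ (same-position second-U₀ U₀-sews)) U₀≡last))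
  ... | inj₂ second-U₁ =
    let t , t-L₁ , t<second = lower-before (s≤s (s≤s z≤n)) second-U₁
        t≡0 = ℕ.n<1⇒n≡0 (subst (toℕ t <_) toℕ-second t<second)
    in contradiction (same-cell t-L₁ L₀-sews (trans t≡0 (sym L₀≡0))) λ ()

  -- U₀'s level-0 end is preceded by L₀
  rising-follows : entry U₀ ≡ 0 → toℕ U₀ ≡ suc (toℕ L₀)
  rising-follows entry≡0 =
    let v , v→U₀ = previous-of U₀
        v-sews = odd-exit 0 (neighbours-of-zero (subst (exit v ~_) entry≡0 (link v U₀ v→U₀)))
    in no-wrap (subst (λ t → Next t U₀) (same-position v-sews L₀-sews) v→U₀)
    where
    -- U₀ is not the first stitch, as L₀ comes earlier
    no-wrap : Next L₀ U₀ → toℕ U₀ ≡ suc (toℕ L₀)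
    no-wrap (inj₁ U₀≡L₀+1) = U₀≡L₀+1
    no-wrap (inj₂ (_ , U₀≡0)) = contradiction (subst (toℕ L₀ <_) U₀≡0 L₀<U₀) λ ()

  upper₁-before : toℕ U₀ ≡ suc (toℕ L₀) → ∃ λ v → Next v L₀ × Sews v 1 upper
  upper₁-before U₀≡L₀+1 with previous-of L₀
  ... | v , v→L₀ with near-zero (before-lower v→L₀ L₀-sews)
  ... | inj₁ v-U₀ = contradiction (subst (λ t → Next t L₀) (same-position v-U₀ U₀-sews) v→L₀)
                                  (no-back-and-forth U₀≡L₀+1)
  ... | inj₂ v-U₁ = v , v→L₀ , v-U₁

  lower₁-after : toℕ U₀ ≡ suc (toℕ L₀) → exit U₀ ≡ 2 → ∃ λ w → Next U₀ w × Sews w 1 lower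
  lower₁-after U₀≡L₀+1 exit≡2 with next-of U₀
  ... | w , U₀→w with neighbours-of-two (~-sym (subst (_~ entry w) exit≡2 (link U₀ w U₀→w)))
  ... | inj₁ entry≡1 = contradiction (subst (Next U₀) (same-position (odd-entry 0 entry≡1) L₀-sews) U₀→w)
                                     (no-back-and-forth U₀≡L₀+1)
  ... | inj₂ entry≡3 = w , U₀→w , odd-entry 1 entry≡3

  below-three : ∀ {k} → k < 3 → k ≡ 0 ⊎ k ≡ 1 ⊎ k ≡ 2
  below-three (s≤s z≤n) = inj₁ refl
  below-three (s≤s (s≤s z≤n)) = inj₂ (inj₁ refl)
  below-three (s≤s (s≤s (s≤s z≤n))) = inj₂ (inj₂ refl)

  -- Thread starting L₀ U₀ L₁ and ending with U₁: the fourth stitch is an upper diagonal next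
  -- to L₁, but U₀ and U₁ are placed elsewhere and the lower diagonal of cell 2 has no room.
  starts-L₀U₀L₁ : ∀ {v w} → Sews v 1 upper → Sews w 1 lower →
                  toℕ L₀ ≡ 0 → toℕ U₀ ≡ 1 → toℕ w ≡ 2 → toℕ v ≡ N ∸ 1 → ⊥
  starts-L₀U₀L₁ {v} {w} v-U₁ w-L₁ L₀≡0 U₀≡1 w≡2 v≡last
    with near-one (after-lower w-L₁ (inj₁ (trans toℕ-fourth (cong suc (sym w≡2)))))
  ... | inj₁ fourth-U₀ =
    contradiction (trans (sym toℕ-fourth) (trans (cong toℕ (same-position fourth-U₀ U₀-sews)) U₀≡1)) λ ()
  ... | inj₂ (inj₁ fourth-U₁) = small≢last (s≤s (s≤s (s≤s (s≤s z≤n))))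
          (trans (sym toℕ-fourth) (trans (cong toℕ (same-position fourth-U₁ v-U₁)) v≡last))
  ... | inj₂ (inj₂ fourth-U₂) with lower-before (s≤s (s≤s (s≤s z≤n))) fourth-U₂
  ...   | t , t-L₂ , t<fourth with below-three (subst (toℕ t <_) toℕ-fourth t<fourth)
  ...     | inj₁ t≡0 = contradiction (same-cell t-L₂ L₀-sews (trans t≡0 (sym L₀≡0))) λ ()
  ...     | inj₂ (inj₁ t≡1) = contradiction (same-cell t-L₂ U₀-sews (trans t≡1 (sym U₀≡1))) λ ()
  ...     | inj₂ (inj₂ t≡2) = contradiction (same-cell t-L₂ w-L₁ (trans t≡2 (sym w≡2))) λ ()

  -- Thread starting with L₁ and ending U₁ L₀ U₀: the second stitch is an upper diagonal next
  -- to L₁, but U₀ and U₁ are placed elsewhere and the lower diagonal of cell 2 has no room.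
  ends-U₁L₀U₀ : ∀ {v w} → Sews v 1 upper → Sews w 1 lower →
                toℕ w ≡ 0 → toℕ L₀ ≡ suc (toℕ v) → toℕ U₀ ≡ suc (toℕ L₀) → toℕ U₀ ≡ N ∸ 1 → ⊥
  ends-U₁L₀U₀ {v} {w} v-U₁ w-L₁ w≡0 L₀≡v+1 U₀≡L₀+1 U₀≡last
    with near-one (after-lower w-L₁ (inj₁ (trans toℕ-second (cong suc (sym w≡0)))))
  ... | inj₁ second-U₀ = small≢last (s≤s (s≤s z≤n))
          (trans (sym toℕ-second) (trans (cong toℕ (same-position second-U₀ U₀-sews)) U₀≡last))
  ... | inj₂ (inj₁ second-U₁) = small≢last (s≤s (s≤s (s≤s (s≤s z≤n))))
          (trans (sym U₀-at-3) U₀≡last)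
    where
    U₀-at-3 : toℕ U₀ ≡ 3
    U₀-at-3 = trans U₀≡L₀+1 (cong suc (trans L₀≡v+1 (cong suc
                (trans (cong toℕ (same-position v-U₁ second-U₁)) toℕ-second))))
  ... | inj₂ (inj₂ second-U₂) =
    let t , t-L₂ , t<second = lower-before (s≤s (s≤s (s≤s z≤n))) second-U₂
        t≡0 = ℕ.n<1⇒n≡0 (subst (toℕ t <_) toℕ-second t<second)
    in contradiction (same-cell t-L₂ w-L₁ (trans t≡0 (sym w≡0))) λ ()

  -- U₀ enters at level 0 and leaves at level 2: the thread runs U₁ L₀ U₀ L₁ and lower-first
  -- for cell 1 forces it to wrap around inside this stretch, at either end.
  rising : entry U₀ ≡ 0 → exit U₀ ≡ 2 → ⊥
  rising entry≡0 exit≡2 =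
    let U₀≡L₀+1 = rising-follows entry≡0
        v , v→L₀ , v-U₁ = upper₁-before U₀≡L₀+1
        w , U₀→w , w-L₁ = lower₁-after U₀≡L₀+1 exit≡2
        w<v = lower-precedes w v (trans (proj₁ w-L₁) (sym (proj₁ v-U₁))) (proj₂ w-L₁) (proj₂ v-U₁)
    in squeeze U₀≡L₀+1 v→L₀ U₀→w v-U₁ w-L₁ w<v
    where
    squeeze : ∀ {v w} → toℕ U₀ ≡ suc (toℕ L₀) → Next v L₀ → Next U₀ w →
              Sews v 1 upper → Sews w 1 lower → toℕ w < toℕ v → ⊥
    squeeze {v} {w} U₀≡L₀+1 (inj₁ L₀≡v+1) (inj₁ w≡U₀+1) _ _ w<v = ℕ.<-asym w<v v<w
      where
      open ℕ.≤-Reasoning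
      v<w : toℕ v < toℕ w
      v<w = begin-strict
        toℕ v        <⟨ ℕ.n<1+n _ ⟩
        suc (toℕ v)  ≡⟨ L₀≡v+1 ⟨
        toℕ L₀       <⟨ L₀<U₀ ⟩
        toℕ U₀       <⟨ ℕ.n<1+n _ ⟩
        suc (toℕ U₀) ≡⟨ w≡U₀+1 ⟨
        toℕ w        ∎
    squeeze U₀≡L₀+1 (inj₂ (v≡last , L₀≡0)) (inj₁ w≡U₀+1) v-U₁ w-L₁ _ =
      starts-L₀U₀L₁ v-U₁ w-L₁ L₀≡0 U₀≡1 (trans w≡U₀+1 (cong suc U₀≡1)) v≡last
      where
      U₀≡1 = trans U₀≡L₀+1 (cong suc L₀≡0)
    squeeze U₀≡L₀+1 (inj₁ L₀≡v+1) (inj₂ (U₀≡last , w≡0)) v-U₁ w-L₁ _ =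
      ends-U₁L₀U₀ v-U₁ w-L₁ w≡0 L₀≡v+1 U₀≡L₀+1 U₀≡last
    squeeze U₀≡L₀+1 (inj₂ (_ , L₀≡0)) (inj₂ (U₀≡last , _)) _ _ _ =
      small≢last (s≤s (s≤s z≤n)) (trans (sym (trans U₀≡L₀+1 (cong suc L₀≡0))) U₀≡last)

  impossible : ⊥
  impossible with upper₀-levels (ends-of U₀-sews)
  ... | inj₁ (entry≡0 , exit≡2) = rising entry≡0 exit≡2
  ... | inj₂ (_ , exit≡0) = falling exit≡0

no-strong-embroidery : ∀ n → 3 ≤ n → ¬ StronglyEmbroiderable n (staircase n)
no-strong-embroidery n 3≤n (e , short , closing) = NoClosedTour.impossible (Shadow.tour e short closing) 3≤n

mainTheorem3 : ((n : ℕ) → n ≥ 2 → Embroiderable n (staircase n))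
    × ((n : ℕ) → n ≥ 2 → (StronglyEmbroiderable n (staircase n) ⇔ n ≡ 2))
mainTheorem3 =
  (λ n _ → staircase-embroiderable n) ,
  λ n n≥2 → mk⇔ (only-two n n≥2) λ { refl → staircase₂-strongly-embroiderable }
  where
  only-two : ∀ n → n ≥ 2 → StronglyEmbroiderable n (staircase n) → n ≡ 2
  only-two n n≥2 strong with ℕ.m≤n⇒m<n∨m≡n n≥2
  ... | inj₁ 3≤n = contradiction strong (no-strong-embroidery n 3≤n)
  ... | inj₂ 2≡n = sym 2≡n
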